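{- For every integer $k\ge3$ there exists a uniquely $(3,2)$-colorable graph $G_k$ with $k+2$ vertices.
   Context: All graphs are simple, connected and undirected; $N_G(v)$ is the open neighborhood, $d(v)=|N_G(v)|$, $\Delta$ the maximum degree. For a coloring $c$ and vertex set $S$, $c(S)=\{c(u):u\in S\}$. For integers $k'>0$ and $0<r\le\Delta(G)$ with $r\le k'$, a conditional $(k',r)$-coloring of $G$ is a surjective map $c:V(G)\to\{1,\dots,k'\}$ such that (C1) $c(u)\ne c(v)$ whenever $uv\in E(G)$, and (C2) $|c(N_G(v))|\ge\min\{d(v),r\}$ for every vertex $v$. $\chi_r(G)$ is the smallest $k'$ for which $G$ has a conditional $(k',r)$-coloring. $G$ is uniquely $(k',r)$-colorable if $\chi_r(G)=k'$ and every conditional $(k',r)$-coloring of $G$ induces the same partition of $V(G)$ into color classes. -}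

module Defs where

open import Data.Nat using (ℕ; zero; suc; _≤_; _<_; _⊔_; _⊓_)
open import Data.Fin using (Fin; _≟_)
open import Data.Bool using (Bool; true; false; _∧_; if_then_else_)
open import Data.List using (List; []; _∷_; map; foldr; allFin)
open import Data.Bool.ListAction using (any)
open import Data.Product using (Σ; ∃; _×_; _,_)
open import Relation.Binary.PropositionalEquality using (_≡_; _≢_)
open import Relation.Nullary.Decidable using (⌊_⌋)
open import Relation.Nullary using (¬_)
open import Function.Bundles using (_⇔_)

record Graph (n : ℕ) : Set where
  field
    adj    : Fin n → Fin n → Bool
    sym    : ∀ u v → adj u v ≡ adj v u
    irrefl : ∀ v → adj v v ≡ false
open Graph public

data Walk {n : ℕ} (G : Graph n) : Fin n → Fin n → Set where
  here : ∀ {v} → Walk G v v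
  step : ∀ {u w v} → adj G u w ≡ true → Walk G w v → Walk G u v

Connected : ∀ {n} → Graph n → Set
Connected G = ∀ u v → Walk G u v

countTrue : List Bool → ℕ
countTrue []            = 0
countTrue (true  ∷ bs)  = suc (countTrue bs)
countTrue (false ∷ bs)  = countTrue bs

deg : ∀ {n} → Graph n → Fin n → ℕ
deg {n} G v = countTrue (map (adj G v) (allFin n))

maxDeg : ∀ {n} → Graph n → ℕ
maxDeg {n} G = foldr _⊔_ 0 (map (deg G) (allFin n))

nbrColours : ∀ {n k} → Graph n → (Fin n → Fin k) → Fin n → ℕ
nbrColours {n} {k} G c v =
  countTrue (map (λ j → any (λ u → adj G v u ∧ ⌊ c u ≟ j ⌋) (allFin n)) (allFin k))

record IsCondColouring {n : ℕ} (G : Graph n) (k r : ℕ) (c : Fin n → Fin k) : Set where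
  field
    surjective : ∀ (j : Fin k) → ∃ λ u → c u ≡ j
    proper     : ∀ u v → adj G u v ≡ true → c u ≢ c v
    cond       : ∀ v → deg G v ⊓ r ≤ nbrColours G c v

HasCondColouring : ∀ {n} → Graph n → ℕ → ℕ → Set
HasCondColouring {n} G k r = Σ (Fin n → Fin k) λ c → IsCondColouring G k r c

ChiEq : ∀ {n} → Graph n → (r k : ℕ) → Set
ChiEq G r k = HasCondColouring G k r × (∀ k′ → k′ < k → ¬ HasCondColouring G k′ r)

UniquelyColourable : ∀ {n} → Graph n → (k r : ℕ) → Set
UniquelyColourable {n} G k r =
  ChiEq G r k ×
  (∀ (c₁ c₂ : Fin n → Fin k) → IsCondColouring G k r c₁ → IsCondColouring G k r c₂ →
     ∀ u v → (c₁ u ≡ c₁ v) ⇔ (c₂ u ≡ c₂ v))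

-- G_k is the triangular book K₁,₁,ₖ: a spine edge joined to k pairwise non-adjacent
-- pages. Its partition {spine vertex, spine vertex, pages} is a conditional
-- (3,2)-colouring, and the triangle through the spine forces three colours. In any
-- proper 3-colouring the spine uses two colours, so every page, adjacent to both
-- spine vertices, gets the third one: all such colourings induce the same partition.
module Submission where

open import Defs
open import Data.Nat using (ℕ; zero; suc; _≤_; _<_; _+_; _⊔_; z≤n; s≤s)
open import Data.Nat.Properties
  using (≤-refl; ≤-trans; n≤1+n; +-comm; m≤n⇒m≤n⊔o; m≤n⇒m≤o⊔n; m⊓n≤n; <⇒≱; n<1+n)
open import Data.Fin using (Fin; zero; suc; _≟_)
open import Data.Fin.Properties using (injective⇒≤)
open import Data.Bool using (Bool; true; false; not; _∧_)
open import Data.Bool.Properties using (T-≡; T-∧)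
open import Data.Bool.ListAction using (any)
open import Data.List using (_∷_; map; allFin; tabulate)
open import Data.List.Properties using (map-tabulate; foldr-preservesᵒ)
open import Data.List.Membership.Propositional using (lose)
open import Data.List.Membership.Propositional.Properties using (∈-allFin; ∈-map⁺)
open import Data.List.Relation.Unary.Any.Properties using (any⁺)
open import Data.Vec using ([]; _∷_)
open import Data.Vec.Relation.Unary.All using ([]; _∷_)
open import Data.Vec.Relation.Unary.Unique.Propositional using (Unique; []; _∷_)
open import Data.Vec.Relation.Unary.Unique.Propositional.Properties using (lookup-injective)
open import Data.Product using (Σ; _×_; _,_)
open import Data.Sum using (_⊎_; inj₁; inj₂)
open import Data.Empty using (⊥-elim)
open import Function using (_∘_)
open import Function.Bundles using (_⇔_; mk⇔; Equivalence)
import Function.Properties.Equivalence as ⇔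
open import Relation.Nullary using (¬_; yes; no; does)
open import Relation.Nullary.Decidable using (⌊_⌋; dec-true; dec-false; decidable-stable; fromWitness)
open import Relation.Binary.PropositionalEquality as ≡ using (_≡_; _≢_; refl; cong; subst)

Proper : ∀ {n k} → Graph n → (Fin n → Fin k) → Set
Proper G c = ∀ u v → adj G u v ≡ true → c u ≢ c v

countTrue-∷ : ∀ b bs → countTrue bs ≤ countTrue (b ∷ bs)
countTrue-∷ true  bs = n≤1+n _
countTrue-∷ false bs = ≤-refl

1≤countTrue-tabulate : ∀ {n} (f : Fin n → Bool) i → f i ≡ true → 1 ≤ countTrue (tabulate f)
1≤countTrue-tabulate f zero    fi rewrite fi = s≤s z≤n
1≤countTrue-tabulate f (suc i) fi =
  ≤-trans (1≤countTrue-tabulate (f ∘ suc) i fi) (countTrue-∷ (f zero) _)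

2≤countTrue-tabulate : ∀ {n} (f : Fin n → Bool) {i j} → i ≢ j →
                       f i ≡ true → f j ≡ true → 2 ≤ countTrue (tabulate f)
2≤countTrue-tabulate f {zero}  {zero}  i≢j _  _  = ⊥-elim (i≢j refl)
2≤countTrue-tabulate f {zero}  {suc j} _   fi fj rewrite fi =
  s≤s (1≤countTrue-tabulate (f ∘ suc) j fj)
2≤countTrue-tabulate f {suc i} {zero}  _   fi fj rewrite fj =
  s≤s (1≤countTrue-tabulate (f ∘ suc) i fi)
2≤countTrue-tabulate f {suc i} {suc j} i≢j fi fj =
  ≤-trans (2≤countTrue-tabulate (f ∘ suc) (i≢j ∘ cong suc) fi fj) (countTrue-∷ (f zero) _)

2≤countTrue-allFin : ∀ {n} (f : Fin n → Bool) {i j} → i ≢ j →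
                     f i ≡ true → f j ≡ true → 2 ≤ countTrue (map f (allFin n))
2≤countTrue-allFin {n} f i≢j fi fj rewrite map-tabulate {n = n} (λ i → i) f =
  2≤countTrue-tabulate f i≢j fi fj

any-allFin : ∀ {n} (f : Fin n → Bool) u → f u ≡ true → any f (allFin n) ≡ true
any-allFin f u fu =
  Equivalence.to T-≡ (any⁺ f (lose (∈-allFin u) (Equivalence.from T-≡ fu)))

2≤deg : ∀ {n} (G : Graph n) {v u₁ u₂} → u₁ ≢ u₂ →
        adj G v u₁ ≡ true → adj G v u₂ ≡ true → 2 ≤ deg G v
2≤deg G = 2≤countTrue-allFin (adj G _)

2≤nbrColours : ∀ {n k} (G : Graph n) (c : Fin n → Fin k) {v u₁ u₂} → c u₁ ≢ c u₂ →
               adj G v u₁ ≡ true → adj G v u₂ ≡ true → 2 ≤ nbrColours G c v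
2≤nbrColours G c {v} {u₁} {u₂} c₁≢c₂ e₁ e₂ =
  2≤countTrue-allFin colourSeen c₁≢c₂ (seen u₁ e₁) (seen u₂ e₂)
  where
  colourSeen : Fin _ → Bool
  colourSeen j = any (λ u → adj G v u ∧ ⌊ c u ≟ j ⌋) (allFin _)

  seen : ∀ u → adj G v u ≡ true → colourSeen (c u) ≡ true
  seen u e = any-allFin _ u
    (Equivalence.to T-≡ (Equivalence.from T-∧ (Equivalence.from T-≡ e , fromWitness refl)))

deg≤maxDeg : ∀ {n} (G : Graph n) v → deg G v ≤ maxDeg G
deg≤maxDeg {n} G v =
  foldr-preservesᵒ ⊔-preserves-lower-bound 0 (map (deg G) (allFin n))
    (inj₂ (lose (∈-map⁺ (deg G) (∈-allFin v)) ≤-refl))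
  where
  ⊔-preserves-lower-bound : ∀ x y → deg G v ≤ x ⊎ deg G v ≤ y → deg G v ≤ x ⊔ y
  ⊔-preserves-lower-bound x y (inj₁ d≤x) = m≤n⇒m≤n⊔o y d≤x
  ⊔-preserves-lower-bound x y (inj₂ d≤y) = m≤n⇒m≤o⊔n x d≤y

_++ʷ_ : ∀ {n} {G : Graph n} {u w v} → Walk G u w → Walk G w v → Walk G u v
here       ++ʷ q = q
step e p   ++ʷ q = step e (p ++ʷ q)

dominating⇒connected : ∀ {n} (G : Graph n) h → (∀ v → v ≢ h → adj G v h ≡ true) → Connected G
dominating⇒connected G h dominating u v = toHub u ++ʷ fromHub v
  where
  toHub : ∀ u → Walk G u h
  toHub u with u ≟ h
  ... | yes refl = here
  ... | no  u≢h  = step (dominating u u≢h) here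

  fromHub : ∀ v → Walk G h v
  fromHub v with v ≟ h
  ... | yes refl = here
  ... | no  v≢h  = step (≡.trans (sym G h v) (dominating v v≢h)) here

clique⇒≤colours : ∀ {n s k} (G : Graph n) (q : Fin s → Fin n) →
                  (∀ i j → i ≢ j → adj G (q i) (q j) ≡ true) →
                  (c : Fin n → Fin k) → Proper G c → s ≤ k
clique⇒≤colours G q clique c proper = injective⇒≤ {f = c ∘ q} λ {i} {j} cqi≡cqj →
  decidable-stable (i ≟ j) λ i≢j → proper (q i) (q j) (clique i j i≢j) cqi≡cqj

sameClasses⇒samePartition : ∀ {n k r m} (G : Graph n) (p : Fin n → Fin m) →
  (∀ c → IsCondColouring G k r c → ∀ u v → (c u ≡ c v) ⇔ (p u ≡ p v)) →
  ∀ c₁ c₂ → IsCondColouring G k r c₁ → IsCondColouring G k r c₂ →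
  ∀ u v → (c₁ u ≡ c₁ v) ⇔ (c₂ u ≡ c₂ v)
sameClasses⇒samePartition G p classes c₁ c₂ C₁ C₂ u v =
  ⇔.trans (classes c₁ C₁ u v) (⇔.sym (classes c₂ C₂ u v))

completeMultipartite : ∀ {n k} → (Fin n → Fin k) → Graph n
completeMultipartite p = record
  { adj    = λ u v → not (does (p u ≟ p v))
  ; sym    = λ u v → cong not (≟-does-sym (p u) (p v))
  ; irrefl = λ v → cong not (dec-true (p v ≟ p v) refl)
  }
  where
  ≟-does-sym : ∀ {k} (a b : Fin k) → does (a ≟ b) ≡ does (b ≟ a)
  ≟-does-sym a b with a ≟ b | b ≟ a
  ... | yes _   | yes _   = refl
  ... | no  _   | no  _   = refl
  ... | yes a≡b | no  b≢a = ⊥-elim (b≢a (≡.sym a≡b))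
  ... | no  a≢b | yes b≡a = ⊥-elim (a≢b (≡.sym b≡a))

module CompleteMultipartite {n k} (p : Fin n → Fin k) where

  private G = completeMultipartite p

  multipartite-adj : ∀ {u v} → p u ≢ p v → adj G u v ≡ true
  multipartite-adj {u} {v} pu≢pv = cong not (dec-false (p u ≟ p v) pu≢pv)

  multipartite-partProper : Proper G p
  multipartite-partProper u v e pu≡pv with p u ≟ p v
  multipartite-partProper u v () pu≡pv | yes _
  ... | no pu≢pv = pu≢pv pu≡pv

  multipartite-sameColour⇒samePart : ∀ {m} (c : Fin n → Fin m) → Proper G c →
                                      ∀ {u v} → c u ≡ c v → p u ≡ p v
  multipartite-sameColour⇒samePart c proper {u} {v} cu≡cv =
    decidable-stable (p u ≟ p v) λ pu≢pv → proper u v (multipartite-adj pu≢pv) cu≡cv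

  multipartite-2≤nbrParts : ∀ v u₁ u₂ → p u₁ ≢ p u₂ → p v ≢ p u₁ → p v ≢ p u₂ →
                            2 ≤ nbrColours G p v
  multipartite-2≤nbrParts _ _ _ p₁≢p₂ v≢₁ v≢₂ =
    2≤nbrColours G p p₁≢p₂ (multipartite-adj v≢₁) (multipartite-adj v≢₂)

-- Otherwise x, y, a, b would be four distinct elements of Fin 3.
Fin3-avoiding-two⇒≡ : ∀ {a b x y : Fin 3} → a ≢ b → x ≢ a → x ≢ b → y ≢ a → y ≢ b → x ≡ y
Fin3-avoiding-two⇒≡ {a} {b} {x} {y} a≢b x≢a x≢b y≢a y≢b =
  decidable-stable (x ≟ y) λ x≢y →
    <⇒≱ (n<1+n 3) (injective⇒≤ (lookup-injective (distinct x≢y) _ _))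
  where
  distinct : x ≢ y → Unique (x ∷ y ∷ a ∷ b ∷ [])
  distinct x≢y = (x≢y ∷ x≢a ∷ x≢b ∷ []) ∷ (y≢a ∷ y≢b ∷ []) ∷ (a≢b ∷ []) ∷ [] ∷ []

bookPart : ∀ {m} → Fin (2 + m) → Fin 3
bookPart zero          = zero
bookPart (suc zero)    = suc zero
bookPart (suc (suc _)) = suc (suc zero)

book : ∀ m → Graph (2 + m)
book m = completeMultipartite (bookPart {m})

book-connected : ∀ m → Connected (book m)
book-connected m = dominating⇒connected (book m) zero adjacentToSpine
  where
  adjacentToSpine : ∀ v → v ≢ zero → adj (book m) v zero ≡ true
  adjacentToSpine zero          v≢0 = ⊥-elim (v≢0 refl)
  adjacentToSpine (suc zero)    _   = refl
  adjacentToSpine (suc (suc _)) _   = refl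

module _ (m : ℕ) where

  open CompleteMultipartite (bookPart {suc m})

  private
    G = book (suc m)

    triangle : Fin 3 → Fin (3 + m)
    triangle zero          = zero
    triangle (suc zero)    = suc zero
    triangle (suc (suc _)) = suc (suc zero)

    partOfTriangle : ∀ j → bookPart (triangle j) ≡ j
    partOfTriangle zero             = refl
    partOfTriangle (suc zero)       = refl
    partOfTriangle (suc (suc zero)) = refl

    triangleClique : ∀ i j → i ≢ j → adj G (triangle i) (triangle j) ≡ true
    triangleClique i j i≢j = multipartite-adj λ parts≡ →
      i≢j (≡.trans (≡.sym (partOfTriangle i)) (≡.trans parts≡ (partOfTriangle j)))

  book-2≤maxDeg : 2 ≤ maxDeg G
  book-2≤maxDeg = ≤-trans (2≤deg G {zero} {suc zero} {suc (suc zero)} (λ ()) refl refl)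
                          (deg≤maxDeg G zero)

  bookPart-isCondColouring : IsCondColouring G 3 2 bookPart
  bookPart-isCondColouring = record
    { surjective = λ j → triangle j , partOfTriangle j
    ; proper     = multipartite-partProper
    ; cond       = λ v → ≤-trans (m⊓n≤n (deg G v) 2) (2≤nbrParts v)
    }
    where
    2≤nbrParts : ∀ v → 2 ≤ nbrColours G bookPart v
    2≤nbrParts v@zero          = multipartite-2≤nbrParts v (suc zero) (suc (suc zero)) (λ ()) (λ ()) (λ ())
    2≤nbrParts v@(suc zero)    = multipartite-2≤nbrParts v zero (suc (suc zero)) (λ ()) (λ ()) (λ ())
    2≤nbrParts v@(suc (suc _)) = multipartite-2≤nbrParts v zero (suc zero) (λ ()) (λ ()) (λ ())

  book-χ₂≡3 : ChiEq G 2 3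
  book-χ₂≡3 = (bookPart , bookPart-isCondColouring) , noSmallerColouring
    where
    noSmallerColouring : ∀ k′ → k′ < 3 → ¬ HasCondColouring G k′ 2
    noSmallerColouring k′ k′<3 (c , C) =
      <⇒≱ k′<3 (clique⇒≤colours G triangle triangleClique c (IsCondColouring.proper C))

  book-colourClasses : ∀ c → Proper G c → ∀ u v → (c u ≡ c v) ⇔ (bookPart u ≡ bookPart v)
  book-colourClasses c proper u v =
    mk⇔ (multipartite-sameColour⇒samePart c proper) (samePart⇒sameColour u v)
    where
    samePart⇒sameColour : ∀ u v → bookPart u ≡ bookPart v → c u ≡ c v
    samePart⇒sameColour zero          zero          _ = refl
    samePart⇒sameColour (suc zero)    (suc zero)    _ = refl
    samePart⇒sameColour (suc (suc i)) (suc (suc j)) _ =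
      Fin3-avoiding-two⇒≡ (proper zero (suc zero) refl)
        (proper (suc (suc i)) zero refl) (proper (suc (suc i)) (suc zero) refl)
        (proper (suc (suc j)) zero refl) (proper (suc (suc j)) (suc zero) refl)
    samePart⇒sameColour zero          (suc zero)    ()
    samePart⇒sameColour zero          (suc (suc _)) ()
    samePart⇒sameColour (suc zero)    zero          ()
    samePart⇒sameColour (suc zero)    (suc (suc _)) ()
    samePart⇒sameColour (suc (suc _)) zero          ()
    samePart⇒sameColour (suc (suc _)) (suc zero)    ()

  book-uniquelyColourable : UniquelyColourable G 3 2
  book-uniquelyColourable = book-χ₂≡3 , sameClasses⇒samePartition G bookPart
    λ c C → book-colourClasses c (IsCondColouring.proper C)

-- One page would suffice; 3 ≤ k only rules out the pageless book.
proposition4p2 : ∀ (k : ℕ) → 3 ≤ k →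
    Σ (Graph (k + 2)) λ G → Connected G × 2 ≤ maxDeg G × UniquelyColourable G 3 2
proposition4p2 k@(suc m) _ = subst Witness (+-comm 2 k)
  (book k , book-connected k , book-2≤maxDeg m , book-uniquelyColourable m)
  where
  Witness : ℕ → Set
  Witness n = Σ (Graph n) λ G → Connected G × 2 ≤ maxDeg G × UniquelyColourable G 3 2
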